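{- Let $v_1\le v_2\le v_3$ be positive integers with $v_2\ge 2v_1$ (and $v_1\ge 2$). Then an optimal $(\bar{1},2)$-LA$(v_2v_3;3,(v_1,v_2,v_3))$ exists, i.e. a $(\bar1,2)$-LA with $v_2v_3$ rows, and $v_2v_3=(\bar1,2)\text{ -LAN}(3,(v_1,v_2,v_3))$.
   Context: For positive integers $N,k,t$ with $t<k$ and $v_1,\dots,v_k$, consider $N\times k$ arrays $A=(a_{rj})$ whose $j$-th column has entries from a set $V_j$ with $|V_j|=v_j$. A $t$-way interaction is $T=\{(j,\sigma_j):j\in I\}$ with $I\subseteq\{1,\dots,k\}$, $|I|=t$, $\sigma_j\in V_j$; $\rho(A,T)$ is the set of rows $r$ with $a_{rj}=\sigma_j$ for all $j\in I$, and $\rho(A,\mathcal T)=\bigcup_{T\in\mathcal T}\rho(A,T)$. $A$ is a $(\bar1,t)$-LA$(N;k,(v_1,\dots,v_k))$ if for all sets $\mathcal T_1,\mathcal T_2$ of $t$-way interactions with $|\mathcal T_1|,|\mathcal T_2|\le 1$: $\rho(A,\mathcal T_1)=\rho(A,\mathcal T_2)\iff\mathcal T_1=\mathcal T_2$ (equivalently: every $t$-way interaction occurs in some row and distinct interactions have distinct $\rho$). $(\bar1,t)$-LAN$(k,(v_1,\dots,v_k))$ is the minimum $N$ for which such an array exists; an LA attaining it is optimal. Throughout the paper all $v_j\ge2$. -}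

module Defs where

open import Data.Nat using (ℕ; _*_; _<_)
open import Data.Fin using (Fin)
import Data.Fin as F
open import Data.Maybe using (Maybe; just; nothing)
open import Data.Product using (Σ; _×_; _,_)
open import Data.Empty using (⊥)
open import Relation.Binary.PropositionalEquality using (_≡_)
open import Function.Bundles using (_⇔_)

Array : (N k : ℕ) → (v : Fin k → ℕ) → Set
Array N k v = Fin N → (j : Fin k) → Fin (v j)

-- A 2-way interaction {(i,σ_i),(j,σ_j)} with i ≠ j, represented canonically
-- with i < j.
record Interaction2 (k : ℕ) (v : Fin k → ℕ) : Set where
  constructor inter
  field
    c₁ : Fin k
    c₂ : Fin k
    c₁<c₂ : c₁ F.< c₂
    σ₁ : Fin (v c₁)
    σ₂ : Fin (v c₂)

open Interaction2 public

InRho : ∀ {N k v} → Array N k v → Interaction2 k v → Fin N → Set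
InRho A T r = (A r (c₁ T) ≡ σ₁ T) × (A r (c₂ T) ≡ σ₂ T)

-- r ∈ ρ(A,𝒯) for a set 𝒯 of at most one interaction (nothing = ∅, just T = {T})
InRhoSet : ∀ {N k v} → Array N k v → Maybe (Interaction2 k v) → Fin N → Set
InRhoSet A nothing r = ⊥
InRhoSet A (just T) r = InRho A T r

SameRho : ∀ {N k v} → Array N k v → (𝒯₁ 𝒯₂ : Maybe (Interaction2 k v)) → Set
SameRho A 𝒯₁ 𝒯₂ = ∀ r → (InRhoSet A 𝒯₁ r ⇔ InRhoSet A 𝒯₂ r)

IsLA-1bar-2 : ∀ {N k v} → Array N k v → Set
IsLA-1bar-2 {N} {k} {v} A =
  (𝒯₁ 𝒯₂ : Maybe (Interaction2 k v)) → (SameRho A 𝒯₁ 𝒯₂ ⇔ (𝒯₁ ≡ 𝒯₂))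

IsLAN-1bar-2 : (k : ℕ) (v : Fin k → ℕ) (N : ℕ) → Set
IsLAN-1bar-2 k v N =
  Σ (Array N k v) IsLA-1bar-2 ×
  (∀ M → M < N → (A : Array M k v) → IsLA-1bar-2 A → ⊥)

-- Index the rows by pairs (b, c) ∈ V₂ × V₃ and put (b + c) mod v₁ in the first column
-- (columns are numbered 0F, 1F, 2F below). Every interaction on the last two columns then
-- occurs exactly once, while, because v₃ ≥ v₂ ≥ 2v₁, every interaction on the first two
-- occurs in two rows with different third entries, and every interaction on the first and
-- third in two rows with different second entries. Of two interactions on different
-- column pairs, one is on the first column and leaves the column it misses unfixed on its
-- rows, while the other fixes it; so their ρ's differ.
-- Conversely, any (1̄,2)-locating array covers all v₂v₃ interactions on the last two
-- columns, and distinct such interactions need distinct rows.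
module Submission where

open import Defs
open import Data.Nat using (ℕ; _*_; _≤_)
open import Data.Vec using (_∷_; [])
open import Data.Vec.Functional using (fromVec)

open import Data.Nat as ℕ using (_+_; _<_; NonZero; z<s; s<s)
open import Data.Nat.Properties
  using (+-assoc; +-comm; +-identityʳ; m≤m+n; m<m+n; <⇒≢; <⇒≱; ≤-trans; ≤-<-trans; <-≤-trans; +-monoˡ-<)
open import Data.Nat.DivMod
  using (_%_; _mod_; %-distribˡ-+; m%n%n≡m%n; m%n<n; [m+n]%n≡m%n; %-remove-+ˡ; m<n⇒m%n≡m)
open import Data.Nat.Divisibility using (m∣m*n)
open import Data.Fin as F using (Fin; toℕ; fromℕ<; combine; remQuot; _≟_)
open import Data.Fin.Patterns using (0F; 1F; 2F)
open import Data.Fin.Properties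
  using (toℕ<n; toℕ-fromℕ<; toℕ-injective; remQuot-combine; combine-remQuot; any?; injective⇒≤)
open import Data.Product using (_×_; _,_; proj₁; proj₂; ∃; ∃₂; uncurry)
open import Data.Maybe using (just; nothing)
open import Data.Empty using (⊥-elim)
open import Relation.Nullary using (¬_; yes; no)
open import Relation.Nullary.Decidable using (_×-dec_)
open import Relation.Binary.PropositionalEquality
open import Function.Base using (_∘_)
open import Function.Definitions using (Injective)
open import Function.Bundles using (mk⇔; Equivalence)
import Function.Properties.Equivalence as ⇔
open Equivalence using (to; from)

[m+n%d]%d≡[m+n]%d : ∀ m n d .{{_ : NonZero d}} → (m + n % d) % d ≡ (m + n) % d
[m+n%d]%d≡[m+n]%d m n d = begin
  (m + n % d) % d         ≡⟨ %-distribˡ-+ m (n % d) d ⟩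
  (m % d + n % d % d) % d ≡⟨ cong (λ x → (m % d + x) % d) (m%n%n≡m%n n d) ⟩
  (m % d + n % d) % d     ≡⟨ %-distribˡ-+ m n d ⟨
  (m + n) % d             ∎
  where open ≡-Reasoning

+-%-solvable : ∀ n .{{_ : NonZero n}} m {a} → a < n → ∃ λ c → c < n × (m + c) % n ≡ a
+-%-solvable n@(ℕ.suc n-1) m {a} a<n = c₀ % n , m%n<n c₀ n , (begin
  (m + c₀ % n) % n ≡⟨ [m+n%d]%d≡[m+n]%d m c₀ n ⟩
  (m + c₀) % n     ≡⟨ cong (_% n) (+-assoc m (n-1 * m) a) ⟨
  (n * m + a) % n  ≡⟨ %-remove-+ˡ a (m∣m*n m) ⟩
  a % n            ≡⟨ m<n⇒m%n≡m a<n ⟩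
  a                ∎)
  where
  open ≡-Reasoning
  -- chosen so that m + c₀ = n * m + a
  c₀ = n-1 * m + a

DoublySurjective : {A B : Set} → (A → B) → Set
DoublySurjective f = ∀ y → ∃₂ λ x x' → x ≢ x' × f x ≡ y × f x' ≡ y

doublySurjective-cong : {A B : Set} {f g : A → B} → f ≗ g → DoublySurjective f → DoublySurjective g
doublySurjective-cong f≗g surj y =
  let x , x' , x≢x' , fx≡y , fx'≡y = surj y
  in x , x' , x≢x' , trans (sym (f≗g x)) fx≡y , trans (sym (f≗g x')) fx'≡y

-- The two preimages of a are c and c + n, where c < n solves (b + c) % n ≡ a.
+-mod-doublySurjective : ∀ {n m} .{{_ : NonZero n}} → n + n ≤ m → ∀ b →
  DoublySurjective (λ (c : Fin m) → (b + toℕ c) mod n)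
+-mod-doublySurjective {n} {m} n+n≤m b a =
  let c , c<n , b+c≡a = +-%-solvable n b (toℕ<n a)
      c+n<m = <-≤-trans (+-monoˡ-< n c<n) n+n≤m
      c<m = ≤-<-trans (m≤m+n c n) c+n<m
      b+[c+n]≡a = trans (cong (_% n) (sym (+-assoc b c n))) (trans ([m+n]%n≡m%n (b + c) n) b+c≡a)
  in fromℕ< c<m , fromℕ< c+n<m ,
     (λ eq → <⇒≢ (m<m+n c (ℕ.>-nonZero⁻¹ n))
               (trans (sym (toℕ-fromℕ< c<m)) (trans (cong toℕ eq) (toℕ-fromℕ< c+n<m)))) ,
     solution c<m b+c≡a , solution c+n<m b+[c+n]≡a
  where
  solution : ∀ {x} (x<m : x < m) → (b + x) % n ≡ toℕ a → (b + toℕ (fromℕ< x<m)) mod n ≡ a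
  solution x<m b+x≡a =
    toℕ-injective (trans (toℕ-fromℕ< _) (trans (cong (λ y → (b + y) % n) (toℕ-fromℕ< x<m)) b+x≡a))

remQuot-injective : ∀ {m} n → Injective _≡_ _≡_ (remQuot {m} n)
remQuot-injective {m} n {x} {y} eq =
  trans (sym (combine-remQuot {m} n x)) (trans (cong (uncurry combine) eq) (combine-remQuot {m} n y))

module _ {N k} {v : Fin k → ℕ} (A : Array N k v) where

  Covers : Set
  Covers = ∀ T → ∃ (InRho A T)

  Separates : Set
  Separates = ∀ T T' → SameRho A (just T) (just T') → T ≡ T'

  covers∧separates⇒isLA : Covers → Separates → IsLA-1bar-2 A
  covers∧separates⇒isLA covers separates 𝒯₁ 𝒯₂ = mk⇔ (sameRho⇒≡ 𝒯₁ 𝒯₂) λ { refl _ → ⇔.refl }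
    where
    sameRho⇒≡ : ∀ 𝒯₁ 𝒯₂ → SameRho A 𝒯₁ 𝒯₂ → 𝒯₁ ≡ 𝒯₂
    sameRho⇒≡ nothing nothing _ = refl
    sameRho⇒≡ nothing (just T) s = ⊥-elim (from (s _) (proj₂ (covers T)))
    sameRho⇒≡ (just T) nothing s = ⊥-elim (to (s _) (proj₂ (covers T)))
    sameRho⇒≡ (just T) (just T') s = cong just (separates T T' s)

  -- An interaction occurring in no row would have the same ρ as the empty set.
  isLA⇒covers : IsLA-1bar-2 A → Covers
  isLA⇒covers isLA T with any? (λ r → (A r (c₁ T) ≟ σ₁ T) ×-dec (A r (c₂ T) ≟ σ₂ T))
  ... | yes covered = covered
  ... | no uncovered with to (isLA (just T) nothing) (λ r → mk⇔ (λ h → uncovered (r , h)) ⊥-elim)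
  ... | ()

  isLA⇒v*v≤N : IsLA-1bar-2 A → ∀ {i j} → i F.< j → v i * v j ≤ N
  isLA⇒v*v≤N isLA {i} {j} i<j =
    injective⇒≤ {f = row ∘ remQuot (v j)} (remQuot-injective (v j) ∘ row-injective)
    where
    covering : ∀ a b → ∃ (InRho A (inter i j i<j a b))
    covering a b = isLA⇒covers isLA (inter i j i<j a b)

    row : Fin (v i) × Fin (v j) → Fin N
    row (a , b) = proj₁ (covering a b)

    row-injective : Injective _≡_ _≡_ row
    row-injective {a , b} {a' , b'} eq with covering a b | covering a' b' | eq
    ... | r , refl , refl | .r , refl , refl | refl = refl

  Determines : Interaction2 k v → Fin k → Set
  Determines T j = ∃ λ x → ∀ r → InRho A T r → A r j ≡ x

  determines-c₁ : ∀ T → Determines T (c₁ T)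
  determines-c₁ T = σ₁ T , λ _ → proj₁

  determines-c₂ : ∀ T → Determines T (c₂ T)
  determines-c₂ T = σ₂ T , λ _ → proj₂

  sameRho⇒determines : ∀ T T' {j} → SameRho A (just T) (just T') → Determines T' j → Determines T j
  sameRho⇒determines _ _ s (x , determined) = x , λ r h → determined r (to (s r) h)

  twoValues⇒¬determines : ∀ T j {r r'} → InRho A T r → InRho A T r' → A r j ≢ A r' j → ¬ Determines T j
  twoValues⇒¬determines _ _ h h' ≢ (x , determined) = ≢ (trans (determined _ h) (sym (determined _ h')))

  sameColumns⇒≡ : Covers → ∀ {i j} (i<j : i F.< j) {a a' b b'} →
    SameRho A (just (inter i j i<j a b)) (just (inter i j i<j a' b')) → inter i j i<j a b ≡ inter i j i<j a' b'
  sameColumns⇒≡ covers i<j {a} {b = b} s with covers (inter _ _ i<j a b)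
  ... | r , h@(refl , refl) with to (s r) h
  ... | refl , refl = refl

data Columns₃ {v : Fin 3 → ℕ} : Interaction2 3 v → Set where
  on₀₁ : ∀ a b → Columns₃ (inter 0F 1F z<s a b)
  on₀₂ : ∀ a c → Columns₃ (inter 0F 2F z<s a c)
  on₁₂ : ∀ b c → Columns₃ (inter 1F 2F (s<s z<s) b c)

columns₃ : ∀ {v} (T : Interaction2 3 v) → Columns₃ T
columns₃ (inter 0F 1F z<s a b) = on₀₁ a b
columns₃ (inter 0F 2F z<s a c) = on₀₂ a c
columns₃ (inter 1F 2F (s<s z<s) b c) = on₁₂ b c

-- If ρ(T) = ρ(T') then T determines both columns of T'. For distinct column pairs one of
-- T, T' lies on {0F,1F} or {0F,2F} and the other uses the column it misses.
separates₃ : ∀ {N} {v : Fin 3 → ℕ} (A : Array N 3 v) → Covers A →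
  (∀ a b → ¬ Determines A (inter 0F 1F z<s a b) 2F) →
  (∀ a c → ¬ Determines A (inter 0F 2F z<s a c) 1F) →
  Separates A
separates₃ A covers ¬det₂ ¬det₁ T T' s with columns₃ T | columns₃ T'
... | on₀₁ a b | on₀₁ _ _ = sameColumns⇒≡ A covers z<s s
... | on₀₁ a b | on₀₂ _ _ = ⊥-elim (¬det₂ a b (sameRho⇒determines A T T' s (determines-c₂ A T')))
... | on₀₁ a b | on₁₂ _ _ = ⊥-elim (¬det₂ a b (sameRho⇒determines A T T' s (determines-c₂ A T')))
... | on₀₂ a c | on₀₁ _ _ = ⊥-elim (¬det₁ a c (sameRho⇒determines A T T' s (determines-c₂ A T')))
... | on₀₂ a c | on₀₂ _ _ = sameColumns⇒≡ A covers z<s s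
... | on₀₂ a c | on₁₂ _ _ = ⊥-elim (¬det₁ a c (sameRho⇒determines A T T' s (determines-c₁ A T')))
... | on₁₂ _ _ | on₀₁ a b = ⊥-elim (¬det₂ a b (sameRho⇒determines A T' T (⇔.sym ∘ s) (determines-c₂ A T)))
... | on₁₂ _ _ | on₀₂ a c = ⊥-elim (¬det₁ a c (sameRho⇒determines A T' T (⇔.sym ∘ s) (determines-c₁ A T)))
... | on₁₂ _ _ | on₁₂ _ _ = sameColumns⇒≡ A covers (s<s z<s) s

module SumModArray (v₁ v₂ v₃ : ℕ) .{{_ : NonZero v₁}} (2v₁≤v₂ : 2 * v₁ ≤ v₂) (v₂≤v₃ : v₂ ≤ v₃) where

  V : Fin 3 → ℕ
  V = fromVec (v₁ ∷ v₂ ∷ v₃ ∷ [])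

  entries : Fin v₂ → Fin v₃ → (j : Fin 3) → Fin (V j)
  entries b c 0F = (toℕ b + toℕ c) mod v₁
  entries b c 1F = b
  entries b c 2F = c

  A : Array (v₂ * v₃) 3 V
  A r = uncurry entries (remQuot v₃ r)

  A-combine : ∀ b c j → A (combine b c) j ≡ entries b c j
  A-combine b c j = cong (λ (b , c) → entries b c j) (remQuot-combine b c)

  combine-inRho : ∀ {b c} T → entries b c (c₁ T) ≡ σ₁ T → entries b c (c₂ T) ≡ σ₂ T → InRho A T (combine b c)
  combine-inRho {b} {c} T e₁ e₂ = trans (A-combine b c (c₁ T)) e₁ , trans (A-combine b c (c₂ T)) e₂

  combine-≢ : ∀ {b b' c c'} j → entries b c j ≢ entries b' c' j → A (combine b c) j ≢ A (combine b' c') j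
  combine-≢ {b} {b'} {c} {c'} j ≢ eq = ≢ (trans (sym (A-combine b c j)) (trans eq (A-combine b' c' j)))

  v₁+v₁≤v₂ : v₁ + v₁ ≤ v₂
  v₁+v₁≤v₂ = subst (λ x → v₁ + x ≤ v₂) (+-identityʳ v₁) 2v₁≤v₂

  column₀-doublySurjectiveʳ : ∀ b → DoublySurjective (λ c → entries b c 0F)
  column₀-doublySurjectiveʳ b = +-mod-doublySurjective (≤-trans v₁+v₁≤v₂ v₂≤v₃) (toℕ b)

  column₀-doublySurjectiveˡ : ∀ c → DoublySurjective (λ b → entries b c 0F)
  column₀-doublySurjectiveˡ c = doublySurjective-cong (λ b → cong (_mod v₁) (+-comm (toℕ c) (toℕ b)))
                                                     (+-mod-doublySurjective v₁+v₁≤v₂ (toℕ c))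

  covers : Covers A
  covers T with columns₃ T
  ... | on₀₁ a b = let c , _ , _ , e , _ = column₀-doublySurjectiveʳ b a in combine b c , combine-inRho T e refl
  ... | on₀₂ a c = let b , _ , _ , e , _ = column₀-doublySurjectiveˡ c a in combine b c , combine-inRho T e refl
  ... | on₁₂ b c = combine b c , combine-inRho T refl refl

  ¬determines₂ : ∀ a b → ¬ Determines A (inter 0F 1F z<s a b) 2F
  ¬determines₂ a b =
    let c , c' , c≢c' , e , e' = column₀-doublySurjectiveʳ b a
    in twoValues⇒¬determines A T 2F (combine-inRho T e refl) (combine-inRho T e' refl) (combine-≢ 2F c≢c')
    where T = inter 0F 1F z<s a b

  ¬determines₁ : ∀ a c → ¬ Determines A (inter 0F 2F z<s a c) 1F
  ¬determines₁ a c =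
    let b , b' , b≢b' , e , e' = column₀-doublySurjectiveˡ c a
    in twoValues⇒¬determines A T 1F (combine-inRho T e refl) (combine-inRho T e' refl) (combine-≢ 1F b≢b')
    where T = inter 0F 2F z<s a c

  isLA : IsLA-1bar-2 A
  isLA = covers∧separates⇒isLA A covers (separates₃ A covers ¬determines₂ ¬determines₁)

theorem4p18 : (v₁ v₂ v₃ : ℕ) → 2 ≤ v₁ → v₁ ≤ v₂ → v₂ ≤ v₃ → 2 * v₁ ≤ v₂ →
    IsLAN-1bar-2 3 (fromVec (v₁ ∷ v₂ ∷ v₃ ∷ [])) (v₂ * v₃)
theorem4p18 v₁ v₂ v₃ 2≤v₁ _ v₂≤v₃ 2v₁≤v₂ =
  (A , isLA) , λ M M<v₂v₃ A′ isLA′ → <⇒≱ M<v₂v₃ (isLA⇒v*v≤N A′ isLA′ {1F} {2F} (s<s z<s))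
  where
  instance
    v₁≢0 : NonZero v₁
    v₁≢0 = ℕ.>-nonZero (<-≤-trans z<s 2≤v₁)
  open SumModArray v₁ v₂ v₃ 2v₁≤v₂ v₂≤v₃
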